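{- The hypersequent $J=\ \Rightarrow p\,/\!/\,\Rightarrow\Box(\neg\Box\Box p\land\neg\Box\Box q)\,/\!/\,\Rightarrow q$ is not derivable in cut-free $\mathrm{RB}$.
   Context: Hypersequents $S_1\,/\!/\,\dots\,/\!/\,S_n$ are finite lists of sequents $\Gamma\Rightarrow\Delta$ (pairs of finite sets of formulas). Cut-free $\mathrm{RB}$ has: axiom $p\Rightarrow p$; external weakening at the ends ($G$ to $\Rightarrow\,/\!/\,G$, $G$ to $G\,/\!/\,\Rightarrow$); internal weakening in any component; the usual sequent rules for $\neg,\land,\lor$ in any component; $\Box\mathrm{R}$: from $G\,/\!/\,\Gamma\Rightarrow\Delta\,/\!/\,\Rightarrow\phi$ infer $G\,/\!/\,\Gamma\Rightarrow\Box\phi,\Delta$; $\Box\mathrm{L}$: from $G\,/\!/\,\Gamma\Rightarrow\Delta\,/\!/\,\Sigma,\phi\Rightarrow\Lambda\,/\!/\,H$ infer $G\,/\!/\,\Gamma,\Box\phi\Rightarrow\Delta\,/\!/\,\Sigma\Rightarrow\Lambda\,/\!/\,H$; $Sym$: from $S_1\,/\!/\,\dots\,/\!/\,S_n$ infer $S_n\,/\!/\,\dots\,/\!/\,S_1$; and $EC$: from $G\,/\!/\,\Gamma\Rightarrow\Delta\,/\!/\,\Gamma\Rightarrow\Delta\,/\!/\,H$ infer $G\,/\!/\,\Gamma\Rightarrow\Delta\,/\!/\,H$. -}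

module Defs where

open import Data.Nat using (ℕ)
open import Data.List using (List; []; _∷_; _++_; reverse)
open import Data.List.Membership.Propositional using (_∈_)
open import Data.List.Relation.Binary.Pointwise using (Pointwise)
open import Data.Product using (_×_)
open import Function.Bundles using (_⇔_)

data Fm : Set where
  var  : ℕ → Fm
  ¬'_  : Fm → Fm
  _∧'_ : Fm → Fm → Fm
  _∨'_ : Fm → Fm → Fm
  □_   : Fm → Fm

infixr 7 _∧'_
infixr 6 _∨'_
infix 8 ¬'_ □_

-- A sequent Γ ⇒ Δ.  Finite sets are represented by lists; derivability is
-- closed under replacing any component by a set-equal one (rule `set-eq`),
-- so the lists behave exactly as finite sets.
record Seq : Set where
  constructor _⇒_
  field
    ant : List Fm
    suc : List Fm

infix 4 _⇒_

Hyp : Set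
Hyp = List Seq

_≈ₛ_ : List Fm → List Fm → Set
Γ ≈ₛ Δ = ∀ x → (x ∈ Γ) ⇔ (x ∈ Δ)

_≈S_ : Seq → Seq → Set
(Γ ⇒ Δ) ≈S (Γ' ⇒ Δ') = (Γ ≈ₛ Γ') × (Δ ≈ₛ Δ')

data RB : Hyp → Set where
  ax    : ∀ n → RB (((var n ∷ []) ⇒ (var n ∷ [])) ∷ [])
  set-eq : ∀ {G G'} → Pointwise _≈S_ G G' → RB G → RB G'
  EWl   : ∀ {G} → RB G → RB (([] ⇒ []) ∷ G)
  EWr   : ∀ {G} → RB G → RB (G ++ (([] ⇒ []) ∷ []))
  IWL   : ∀ G H {Γ Δ} φ → RB (G ++ (Γ ⇒ Δ) ∷ H) → RB (G ++ (φ ∷ Γ ⇒ Δ) ∷ H)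
  IWR   : ∀ G H {Γ Δ} φ → RB (G ++ (Γ ⇒ Δ) ∷ H) → RB (G ++ (Γ ⇒ φ ∷ Δ) ∷ H)
  ¬L    : ∀ G H {Γ Δ φ} → RB (G ++ (Γ ⇒ φ ∷ Δ) ∷ H) → RB (G ++ (¬' φ ∷ Γ ⇒ Δ) ∷ H)
  ¬R    : ∀ G H {Γ Δ φ} → RB (G ++ (φ ∷ Γ ⇒ Δ) ∷ H) → RB (G ++ (Γ ⇒ ¬' φ ∷ Δ) ∷ H)
  ∧L    : ∀ G H {Γ Δ φ ψ} → RB (G ++ (φ ∷ ψ ∷ Γ ⇒ Δ) ∷ H)
        → RB (G ++ (φ ∧' ψ ∷ Γ ⇒ Δ) ∷ H)
  ∧R    : ∀ G H {Γ Δ φ ψ} → RB (G ++ (Γ ⇒ φ ∷ Δ) ∷ H) → RB (G ++ (Γ ⇒ ψ ∷ Δ) ∷ H)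
        → RB (G ++ (Γ ⇒ φ ∧' ψ ∷ Δ) ∷ H)
  ∨L    : ∀ G H {Γ Δ φ ψ} → RB (G ++ (φ ∷ Γ ⇒ Δ) ∷ H) → RB (G ++ (ψ ∷ Γ ⇒ Δ) ∷ H)
        → RB (G ++ (φ ∨' ψ ∷ Γ ⇒ Δ) ∷ H)
  ∨R    : ∀ G H {Γ Δ φ ψ} → RB (G ++ (Γ ⇒ φ ∷ ψ ∷ Δ) ∷ H)
        → RB (G ++ (Γ ⇒ φ ∨' ψ ∷ Δ) ∷ H)
  □R    : ∀ G {Γ Δ φ} → RB (G ++ (Γ ⇒ Δ) ∷ ([] ⇒ φ ∷ []) ∷ [])
        → RB (G ++ (Γ ⇒ □ φ ∷ Δ) ∷ [])
  □L    : ∀ G H {Γ Δ Σ Λ φ} → RB (G ++ (Γ ⇒ Δ) ∷ (φ ∷ Σ ⇒ Λ) ∷ H)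
        → RB (G ++ (□ φ ∷ Γ ⇒ Δ) ∷ (Σ ⇒ Λ) ∷ H)
  Sym   : ∀ {G} → RB G → RB (reverse G)
  EC    : ∀ G H {S} → RB (G ++ S ∷ S ∷ H) → RB (G ++ S ∷ H)

p q : Fm
p = var 0
q = var 1

J : Hyp
J = ([] ⇒ p ∷ []) ∷ ([] ⇒ □ (¬' □ □ p ∧' ¬' □ □ q) ∷ []) ∷ ([] ⇒ q ∷ []) ∷ []

-- Read a hypersequent as a line of worlds, one per component, each seeing itself
-- and its two neighbours, where an atom holds at a world iff it is not in the
-- succedent of that component.  Call G refuted if at every component all antecedent
-- formulas hold and all succedent formulas fail, where failure of □(¬□□m ∧ ¬□□n) is
-- strengthened to: on each edge at the world, m holds at both ends or n does.  This
-- is what survives □R: the fresh world it opens at the end of the line then satisfies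
-- □□m or □□n.  Refutation only constrains windows of five consecutive components,
-- every rule of cut-free RB turns a refutation of its conclusion into one of some
-- premise, no axiom is refuted, and J is.
module Submission where

open import Defs
open import Level using (0ℓ)
open import Data.Nat using (ℕ)
open import Data.Product using (_×_; _,_; proj₂; ∃-syntax)
open import Data.Sum as Sum using (_⊎_; inj₁; inj₂; [_,_]′; reduce)
open import Data.Unit using (⊤; tt)
open import Data.List using (List; []; _∷_; _++_; reverse)
open import Data.List.Properties using (++-assoc; reverse-++; reverse-involutive)
open import Data.List.Membership.Propositional using (_∉_)
open import Data.List.Relation.Binary.Subset.Propositional using () renaming (_⊆_ to _⊆ˡ_)
open import Data.List.Relation.Binary.Pointwise as Pointwise using (Pointwise; []; _∷_)
open import Data.List.Relation.Unary.All as All using (All; []; _∷_)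
open import Data.List.Relation.Unary.All.Properties using (anti-mono)
open import Data.List.Relation.Unary.Any using (here; there)
open import Function using (_∘_; id)
open import Function.Bundles using (Equivalence)
open import Relation.Nullary using (¬_)
open import Relation.Unary using (Pred; _∩_; _⊆_)
open import Relation.Binary.PropositionalEquality using (_≡_; _≢_; refl; sym; trans; cong; subst; module ≡-Reasoning)

module Windows {A : Set} (ε : A) (R : A → A → A → A → A → Set) where

  HeadWindow : A → List A → Set
  HeadWindow a (b ∷ c ∷ d ∷ e ∷ _) = R a b c d e
  HeadWindow a _                   = ⊤

  data AllWindows : List A → Set where
    []  : AllWindows []
    _∷_ : ∀ {a L} → HeadWindow a L → AllWindows L → AllWindows (a ∷ L)

  ε⁴ : List A
  ε⁴ = ε ∷ ε ∷ ε ∷ ε ∷ []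

  pad : List A → List A
  pad L = ε⁴ ++ L ++ ε⁴

  pad-++ : ∀ G L → pad (G ++ L) ≡ ε⁴ ++ G ++ L ++ ε⁴
  pad-++ G L = cong (ε⁴ ++_) (++-assoc G L ε⁴)

  pad-++-++ : ∀ G M H → pad (G ++ M ++ H) ≡ ε⁴ ++ G ++ M ++ H ++ ε⁴
  pad-++-++ G M H = trans (pad-++ G (M ++ H)) (cong (λ T → ε⁴ ++ G ++ T) (++-assoc M H ε⁴))

  ++ε⁴-elim : {P : List A → Set} → (∀ r₁ r₂ r₃ r₄ T → P (r₁ ∷ r₂ ∷ r₃ ∷ r₄ ∷ T)) →
              ∀ H → P (H ++ ε⁴)
  ++ε⁴-elim p []                    = p ε ε ε ε []
  ++ε⁴-elim p (h₁ ∷ [])             = p h₁ ε ε ε (ε ∷ [])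
  ++ε⁴-elim p (h₁ ∷ h₂ ∷ [])        = p h₁ h₂ ε ε (ε ∷ ε ∷ [])
  ++ε⁴-elim p (h₁ ∷ h₂ ∷ h₃ ∷ [])   = p h₁ h₂ h₃ ε (ε ∷ ε ∷ ε ∷ [])
  ++ε⁴-elim p (h₁ ∷ h₂ ∷ h₃ ∷ h₄ ∷ H) = p h₁ h₂ h₃ h₄ (H ++ ε⁴)

  HeadWindow-++⁻ : ∀ x C {T} → HeadWindow x (C ++ T) → HeadWindow x C
  HeadWindow-++⁻ x []                    _ = tt
  HeadWindow-++⁻ x (_ ∷ [])              _ = tt
  HeadWindow-++⁻ x (_ ∷ _ ∷ [])          _ = tt
  HeadWindow-++⁻ x (_ ∷ _ ∷ _ ∷ [])      _ = tt
  HeadWindow-++⁻ x (_ ∷ _ ∷ _ ∷ _ ∷ _)   w = w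

  HeadWindow-tail-irrelevant : ∀ x C {a b c d T T′} →
    HeadWindow x (C ++ a ∷ b ∷ c ∷ d ∷ T) → HeadWindow x (C ++ a ∷ b ∷ c ∷ d ∷ T′)
  HeadWindow-tail-irrelevant x []                  w = w
  HeadWindow-tail-irrelevant x (_ ∷ [])            w = w
  HeadWindow-tail-irrelevant x (_ ∷ _ ∷ [])        w = w
  HeadWindow-tail-irrelevant x (_ ∷ _ ∷ _ ∷ [])    w = w
  HeadWindow-tail-irrelevant x (_ ∷ _ ∷ _ ∷ _ ∷ _) w = w

  AllWindows-++⁻ˡ : ∀ L {T} → AllWindows (L ++ T) → AllWindows L
  AllWindows-++⁻ˡ []      _       = []
  AllWindows-++⁻ˡ (x ∷ L) (w ∷ v) = HeadWindow-++⁻ x L w ∷ AllWindows-++⁻ˡ L v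

  AllWindows-∷ʳ : ∀ L {a b c d e} → AllWindows (L ++ a ∷ b ∷ c ∷ d ∷ []) → R a b c d e →
                  AllWindows (L ++ a ∷ b ∷ c ∷ d ∷ e ∷ [])
  AllWindows-∷ʳ []      _       r = r ∷ tt ∷ tt ∷ tt ∷ tt ∷ []
  AllWindows-∷ʳ (x ∷ L) (w ∷ v) r = HeadWindow-tail-irrelevant x L w ∷ AllWindows-∷ʳ L v r

  AllWindows-centre : ∀ G {a b x d e T} → AllWindows (a ∷ b ∷ G ++ x ∷ d ∷ e ∷ T) →
                      ∃[ a′ ] ∃[ b′ ] R a′ b′ x d e
  AllWindows-centre []      (w ∷ _) = _ , _ , w
  AllWindows-centre (_ ∷ G) (_ ∷ v) = AllWindows-centre G v

  AllWindows-replace : ∀ G {M M₁ M₂ T} →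
    (∀ {a b c d} → AllWindows (a ∷ b ∷ c ∷ d ∷ M ++ T) →
       AllWindows (a ∷ b ∷ c ∷ d ∷ M₁ ++ T) ⊎ AllWindows (a ∷ b ∷ c ∷ d ∷ M₂ ++ T)) →
    ∀ {a b c d} → AllWindows (a ∷ b ∷ c ∷ d ∷ G ++ M ++ T) →
      AllWindows (a ∷ b ∷ c ∷ d ∷ G ++ M₁ ++ T) ⊎ AllWindows (a ∷ b ∷ c ∷ d ∷ G ++ M₂ ++ T)
  AllWindows-replace []      local v       = local v
  AllWindows-replace (_ ∷ G) {M} {M₁} {M₂} {T} local (w ∷ v) =
    Sum.map (w ∷_) (w ∷_) (AllWindows-replace G {M} {M₁} {M₂} {T} local v)

  record Step₂ (M M₁ M₂ : List A) : Set where
    constructor step₂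
    field
      apply₂ : ∀ {a b c d r₁ r₂ r₃ r₄ T} →
        AllWindows (a ∷ b ∷ c ∷ d ∷ M ++ r₁ ∷ r₂ ∷ r₃ ∷ r₄ ∷ T) →
        AllWindows (a ∷ b ∷ c ∷ d ∷ M₁ ++ r₁ ∷ r₂ ∷ r₃ ∷ r₄ ∷ T) ⊎
        AllWindows (a ∷ b ∷ c ∷ d ∷ M₂ ++ r₁ ∷ r₂ ∷ r₃ ∷ r₄ ∷ T)

  record Step (M M′ : List A) : Set where
    constructor step
    field
      apply : ∀ {a b c d r₁ r₂ r₃ r₄ T} →
        AllWindows (a ∷ b ∷ c ∷ d ∷ M ++ r₁ ∷ r₂ ∷ r₃ ∷ r₄ ∷ T) →
        AllWindows (a ∷ b ∷ c ∷ d ∷ M′ ++ r₁ ∷ r₂ ∷ r₃ ∷ r₄ ∷ T)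

  AllWindows-pad-replace₂ : ∀ G {M M₁ M₂} H → Step₂ M M₁ M₂ → AllWindows (pad (G ++ M ++ H)) →
    AllWindows (pad (G ++ M₁ ++ H)) ⊎ AllWindows (pad (G ++ M₂ ++ H))
  AllWindows-pad-replace₂ G {M} {M₁} {M₂} H (step₂ apply₂) v =
    Sum.map (subst AllWindows (sym (pad-++-++ G M₁ H))) (subst AllWindows (sym (pad-++-++ G M₂ H)))
      (AllWindows-replace G {M} {M₁} {M₂} {H ++ ε⁴} (++ε⁴-elim {Local} (λ _ _ _ _ _ → apply₂) H)
        (subst AllWindows (pad-++-++ G M H) v))
    where
    Local : List A → Set
    Local T = ∀ {a b c d} → AllWindows (a ∷ b ∷ c ∷ d ∷ M ++ T) →
      AllWindows (a ∷ b ∷ c ∷ d ∷ M₁ ++ T) ⊎ AllWindows (a ∷ b ∷ c ∷ d ∷ M₂ ++ T)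

  AllWindows-pad-replace : ∀ G {M M′} H → Step M M′ →
    AllWindows (pad (G ++ M ++ H)) → AllWindows (pad (G ++ M′ ++ H))
  AllWindows-pad-replace G H (step apply) = reduce ∘ AllWindows-pad-replace₂ G H (step₂ (inj₁ ∘ apply))

  AllWindows-pad-replace-last : ∀ G {M M′} →
    (∀ {a b c d} → AllWindows (a ∷ b ∷ c ∷ d ∷ M ++ ε⁴) → AllWindows (a ∷ b ∷ c ∷ d ∷ M′ ++ ε⁴)) →
    AllWindows (pad (G ++ M)) → AllWindows (pad (G ++ M′))
  AllWindows-pad-replace-last G {M} {M′} local v =
    subst AllWindows (sym (pad-++ G M′))
      (reduce (AllWindows-replace G {M} {M′} {M′} {ε⁴} (inj₁ ∘ local) (subst AllWindows (pad-++ G M) v)))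

  AllWindows-pad-centre : ∀ G x H → AllWindows (pad (G ++ x ∷ H)) →
                          ∃[ a ] ∃[ b ] ∃[ d ] ∃[ e ] R a b x d e
  AllWindows-pad-centre G x H v =
    ++ε⁴-elim {Centred} centred H (subst AllWindows (pad-++ G (x ∷ H)) v)
    where
    Centred : List A → Set
    Centred T = AllWindows (ε ∷ ε ∷ (ε ∷ ε ∷ G) ++ x ∷ T) → ∃[ a ] ∃[ b ] ∃[ d ] ∃[ e ] R a b x d e
    centred : ∀ r₁ r₂ r₃ r₄ T → Centred (r₁ ∷ r₂ ∷ r₃ ∷ r₄ ∷ T)
    centred r₁ r₂ _ _ _ w with AllWindows-centre (ε ∷ ε ∷ G) w
    ... | a , b , r = a , b , r₁ , r₂ , r

  AllWindows-pad-init : ∀ G → AllWindows (pad (G ++ ε ∷ [])) → AllWindows (pad G)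
  AllWindows-pad-init G v = AllWindows-++⁻ˡ (pad G) (subst AllWindows pad-∷ʳ v)
    where
    pad-∷ʳ : pad (G ++ ε ∷ []) ≡ pad G ++ ε ∷ []
    pad-∷ʳ = cong (ε⁴ ++_) (trans (++-assoc G (ε ∷ []) ε⁴) (sym (++-assoc G ε⁴ (ε ∷ []))))

  module _ (R-reverse : ∀ a b c d e → R a b c d e → R e d c b a) where

    AllWindows-reverse : ∀ L → AllWindows L → AllWindows (reverse L)
    AllWindows-reverse []                    _ = []
    AllWindows-reverse (_ ∷ [])              _ = tt ∷ []
    AllWindows-reverse (_ ∷ _ ∷ [])          _ = tt ∷ tt ∷ []
    AllWindows-reverse (_ ∷ _ ∷ _ ∷ [])      _ = tt ∷ tt ∷ tt ∷ []
    AllWindows-reverse (_ ∷ _ ∷ _ ∷ _ ∷ [])  _ = tt ∷ tt ∷ tt ∷ tt ∷ []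
    AllWindows-reverse (x ∷ y ∷ z ∷ w ∷ u ∷ L) (r ∷ v) =
      subst AllWindows (sym (reverse-++ (x ∷ y ∷ z ∷ w ∷ u ∷ []) L))
        (AllWindows-∷ʳ (reverse L)
          (subst AllWindows (reverse-++ (y ∷ z ∷ w ∷ u ∷ []) L) (AllWindows-reverse (y ∷ z ∷ w ∷ u ∷ L) v))
          (R-reverse x y z w u r))

    AllWindows-pad-reverse : ∀ L → AllWindows (pad L) → AllWindows (pad (reverse L))
    AllWindows-pad-reverse L v = subst AllWindows reverse-pad (AllWindows-reverse (pad L) v)
      where
      open ≡-Reasoning
      reverse-pad : reverse (pad L) ≡ pad (reverse L)
      reverse-pad = begin
        reverse (ε⁴ ++ L ++ ε⁴)         ≡⟨ reverse-++ ε⁴ (L ++ ε⁴) ⟩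
        reverse (L ++ ε⁴) ++ ε⁴         ≡⟨ cong (_++ ε⁴) (reverse-++ L ε⁴) ⟩
        (ε⁴ ++ reverse L) ++ ε⁴         ∎

  module _ {S : A → A → Set} (S-refl : ∀ {a} → S a a)
    (R-antitone : ∀ {a b c d e a′ b′ c′ d′ e′} → S a a′ → S b b′ → S c c′ → S d d′ → S e e′ →
                  R a′ b′ c′ d′ e′ → R a b c d e) where

    HeadWindow-pointwise : ∀ {a a′ L L′} → S a a′ → Pointwise S L L′ → HeadWindow a′ L′ → HeadWindow a L
    HeadWindow-pointwise s []                      _ = tt
    HeadWindow-pointwise s (_ ∷ [])                _ = tt
    HeadWindow-pointwise s (_ ∷ _ ∷ [])            _ = tt
    HeadWindow-pointwise s (_ ∷ _ ∷ _ ∷ [])        _ = tt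
    HeadWindow-pointwise s (s₁ ∷ s₂ ∷ s₃ ∷ s₄ ∷ _) w = R-antitone s s₁ s₂ s₃ s₄ w

    AllWindows-pointwise : ∀ {L L′} → Pointwise S L L′ → AllWindows L′ → AllWindows L
    AllWindows-pointwise []       _       = []
    AllWindows-pointwise (s ∷ ss) (w ∷ v) = HeadWindow-pointwise s ss w ∷ AllWindows-pointwise ss v

    AllWindows-pad-pointwise : ∀ {L L′} → Pointwise S L L′ → AllWindows (pad L′) → AllWindows (pad L)
    AllWindows-pad-pointwise ss = AllWindows-pointwise (Pointwise.++⁺ ε⁴-refl (Pointwise.++⁺ ss ε⁴-refl))
      where
      ε⁴-refl : Pointwise S ε⁴ ε⁴
      ε⁴-refl = S-refl ∷ S-refl ∷ S-refl ∷ S-refl ∷ []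

Val : Set₁
Val = Pred ℕ 0ℓ

record Nbhd : Set₁ where
  constructor nbhd
  field
    v₋₂ v₋₁ v₀ v₁ v₂ : Val

open Nbhd

Near Far : Nbhd → Val
Near w = v₋₁ w ∩ v₀ w ∩ v₁ w
Far w  = v₋₂ w ∩ v₋₁ w ∩ v₀ w ∩ v₁ w ∩ v₂ w

data Linked (u v : Val) (m n : ℕ) : Set where
  via₁ : u m → v m → Linked u v m n
  via₂ : u n → v n → Linked u v m n

Linked-mono : ∀ {u u′ v v′ m n} → u ⊆ u′ → v ⊆ v′ → Linked u v m n → Linked u′ v′ m n
Linked-mono su sv (via₁ x y) = via₁ (su x) (sv y)
Linked-mono su sv (via₂ x y) = via₂ (su x) (sv y)

Linked-swap : ∀ {u v m n} → Linked u v m n → Linked v u m n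
Linked-swap (via₁ x y) = via₁ y x
Linked-swap (via₂ x y) = via₂ y x

Linked-diagˡ : ∀ {u v m n} → Linked u v m n → Linked u u m n
Linked-diagˡ (via₁ x _) = via₁ x x
Linked-diagˡ (via₂ x _) = via₂ x x

Linked-diagʳ : ∀ {u v m n} → Linked u v m n → Linked v v m n
Linked-diagʳ (via₁ _ y) = via₁ y y
Linked-diagʳ (via₂ _ y) = via₂ y y

Bridged : Nbhd → ℕ → ℕ → Set
Bridged w m n = Linked (v₋₁ w) (v₀ w) m n × Linked (v₀ w) (v₁ w) m n

χ : ℕ → ℕ → Fm
χ m n = ¬' □ □ var m ∧' ¬' □ □ var n

data Holds (w : Nbhd) : Fm → Set where
  holds-var : ∀ {n} → v₀ w n → Holds w (var n)
  holds-□   : ∀ {n} → Near w n → Holds w (□ var n)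
  holds-□□  : ∀ {n} → Far w n → Holds w (□ □ var n)

-- A succedent atom needs no condition: the valuation makes it false (see val below).
data Fails (w : Nbhd) : Fm → Set where
  fails-var : ∀ {n} → Fails w (var n)
  fails-¬   : ∀ {φ} → Holds w φ → Fails w (¬' φ)
  fails-∧ˡ  : ∀ {φ ψ} → Holds w φ → Fails w (¬' φ ∧' ¬' ψ)
  fails-∧ʳ  : ∀ {φ ψ} → Holds w ψ → Fails w (¬' φ ∧' ¬' ψ)
  fails-□   : ∀ {m n} → Bridged w m n → Fails w (□ χ m n)

Refutes : Nbhd → Seq → Set
Refutes w (Γ ⇒ Δ) = All (Holds w) Γ × All (Fails w) Δ

record _≼_ (w w′ : Nbhd) : Set where
  field
    centre  : v₀ w ⊆ v₀ w′
    near    : Near w ⊆ Near w′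
    far     : Far w ⊆ Far w′
    bridged : ∀ {m n} → Bridged w m n → Bridged w′ m n

open _≼_

Holds-≼ : ∀ {w w′} → w ≼ w′ → Holds w ⊆ Holds w′
Holds-≼ w≼ (holds-var h) = holds-var (centre w≼ h)
Holds-≼ w≼ (holds-□ h)   = holds-□ (near w≼ h)
Holds-≼ w≼ (holds-□□ h)  = holds-□□ (far w≼ h)

Fails-≼ : ∀ {w w′} → w ≼ w′ → Fails w ⊆ Fails w′
Fails-≼ w≼ fails-var    = fails-var
Fails-≼ w≼ (fails-¬ h)  = fails-¬ (Holds-≼ w≼ h)
Fails-≼ w≼ (fails-∧ˡ h) = fails-∧ˡ (Holds-≼ w≼ h)
Fails-≼ w≼ (fails-∧ʳ h) = fails-∧ʳ (Holds-≼ w≼ h)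
Fails-≼ w≼ (fails-□ b)  = fails-□ (bridged w≼ b)

Refutes-≼ : ∀ {w w′ S} → w ≼ w′ → Refutes w S → Refutes w′ S
Refutes-≼ w≼ (hs , fs) = All.map (Holds-≼ w≼) hs , All.map (Fails-≼ w≼) fs

_⊑_ : Nbhd → Nbhd → Set
w ⊑ w′ = (v₋₂ w ⊆ v₋₂ w′) × (v₋₁ w ⊆ v₋₁ w′) × (v₀ w ⊆ v₀ w′) × (v₁ w ⊆ v₁ w′) × (v₂ w ⊆ v₂ w′)

⊑⇒≼ : ∀ {w w′} → w ⊑ w′ → w ≼ w′
⊑⇒≼ (s₋₂ , s₋₁ , s₀ , s₁ , s₂) = record
  { centre  = s₀
  ; near    = λ (a , b , c) → s₋₁ a , s₀ b , s₁ c
  ; far     = λ (a , b , c , d , e) → s₋₂ a , s₋₁ b , s₀ c , s₁ d , s₂ e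
  ; bridged = λ (l , r) → Linked-mono s₋₁ s₀ l , Linked-mono s₀ s₁ r
  }

Refutes-⊑ : ∀ {w w′ S} → w ⊑ w′ → Refutes w S → Refutes w′ S
Refutes-⊑ = Refutes-≼ ∘ ⊑⇒≼

≼-reverse : ∀ {a b c d e} → nbhd a b c d e ≼ nbhd e d c b a
≼-reverse = record
  { centre  = id
  ; near    = λ (a , b , c) → c , b , a
  ; far     = λ (a , b , c , d , e) → e , d , c , b , a
  ; bridged = λ (l , r) → Linked-swap r , Linked-swap l
  }

≼-dupʳ : ∀ {a b c d e} → nbhd a b c d e ≼ nbhd a b c d d
≼-dupʳ = record
  { centre  = id
  ; near    = id
  ; far     = λ (a , b , c , d , _) → a , b , c , d , d
  ; bridged = id
  }

≼-dupˡ : ∀ {a b c d e} → nbhd a b c d e ≼ nbhd b b c d e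
≼-dupˡ = record
  { centre  = id
  ; near    = id
  ; far     = λ (_ , b , c , d , e) → b , b , c , d , e
  ; bridged = id
  }

≼-stutterʳ : ∀ {a b c d e} → nbhd a b c d e ≼ nbhd a b c c d
≼-stutterʳ = record
  { centre  = id
  ; near    = λ (b , c , _) → b , c , c
  ; far     = λ (a , b , c , d , _) → a , b , c , c , d
  ; bridged = λ (l , r) → l , Linked-diagˡ r
  }

≼-stutterˡ : ∀ {a b c d e} → nbhd a b c d e ≼ nbhd b c c d e
≼-stutterˡ = record
  { centre  = id
  ; near    = λ (_ , c , d) → c , c , d
  ; far     = λ (_ , b , c , d , e) → b , c , c , d , e
  ; bridged = λ (l , r) → Linked-diagʳ l , r
  }

Holds-□⁻ : ∀ {a b c d e f φ} → Holds (nbhd a b c d e) (□ φ) → Holds (nbhd b c d e f) φ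
Holds-□⁻ (holds-□ (_ , _ , h))        = holds-var h
Holds-□⁻ (holds-□□ (_ , _ , c , d , e)) = holds-□ (c , d , e)

_⊆S_ : Seq → Seq → Set
(Γ′ ⇒ Δ′) ⊆S (Γ ⇒ Δ) = (Γ′ ⊆ˡ Γ) × (Δ′ ⊆ˡ Δ)

⊆S-refl : ∀ {S} → S ⊆S S
⊆S-refl = id , id

Refutes-⊆S : ∀ {w S′ S} → S′ ⊆S S → Refutes w S → Refutes w S′
Refutes-⊆S (Γ⊆ , Δ⊆) (hs , fs) = anti-mono Γ⊆ hs , anti-mono Δ⊆ fs

≈S⇒⊆S : ∀ {S S′} → S ≈S S′ → S ⊆S S′
≈S⇒⊆S (Γ≈ , Δ≈) = (λ {φ} → Equivalence.to (Γ≈ φ)) , (λ {φ} → Equivalence.to (Δ≈ φ))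

val : List Fm → Val
val Δ n = var n ∉ Δ

val-antitone : ∀ {Δ Δ′} → Δ′ ⊆ˡ Δ → val Δ ⊆ val Δ′
val-antitone Δ′⊆Δ n∉Δ = n∉Δ ∘ Δ′⊆Δ

val-replace-head : ∀ {Δ φ ψ} → (∀ {n} → var n ≢ ψ) → val (φ ∷ Δ) ⊆ val (ψ ∷ Δ)
val-replace-head n≢ψ _   (here n≡ψ) = n≢ψ n≡ψ
val-replace-head n≢ψ n∉ (there n∈) = n∉ (there n∈)

∉-singleton : ∀ {n φ} → var n ≢ φ → var n ∉ φ ∷ []
∉-singleton n≢φ (here n≡φ) = n≢φ n≡φ

-- The fresh world opened by □R: whichever of m, n holds on the edge into it makes
-- □□m or □□n hold there, since an empty or χ-only succedent makes every atom true.
Fails-fresh : ∀ {u v m n} → Linked u v m n →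
              Fails (nbhd u v (val (χ m n ∷ [])) (val []) (val [])) (χ m n)
Fails-fresh (via₁ x y) = fails-∧ˡ (holds-□□ (x , y , ∉-singleton (λ ()) , (λ ()) , (λ ())))
Fails-fresh (via₂ x y) = fails-∧ʳ (holds-□□ (x , y , ∉-singleton (λ ()) , (λ ()) , (λ ())))

nbhdOf : Seq → Seq → Seq → Seq → Seq → Nbhd
nbhdOf a b c d e = nbhd (val (Seq.suc a)) (val (Seq.suc b)) (val (Seq.suc c)) (val (Seq.suc d)) (val (Seq.suc e))

RefutedAt : Seq → Seq → Seq → Seq → Seq → Set
RefutedAt a b c d e = Refutes (nbhdOf a b c d e) c

empty : Seq
empty = [] ⇒ []

RefutedAt-antitone : ∀ {a b c d e a′ b′ c′ d′ e′} → a ⊆S a′ → b ⊆S b′ → c ⊆S c′ → d ⊆S d′ → e ⊆S e′ →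
                     RefutedAt a′ b′ c′ d′ e′ → RefutedAt a b c d e
RefutedAt-antitone a⊆ b⊆ c⊆ d⊆ e⊆ = Refutes-⊆S c⊆ ∘ Refutes-⊑
  (val-antitone (proj₂ a⊆) , val-antitone (proj₂ b⊆) , val-antitone (proj₂ c⊆) ,
   val-antitone (proj₂ d⊆) , val-antitone (proj₂ e⊆))

open Windows empty RefutedAt

-- The line continues on both sides with empty components, where every atom is true.
Refuted : Hyp → Set
Refuted G = AllWindows (pad G)

Refuted-unreverse : ∀ G → Refuted (reverse G) → Refuted G
Refuted-unreverse G =
  subst Refuted (reverse-involutive G) ∘ AllWindows-pad-reverse (λ _ _ _ _ _ → Refutes-≼ ≼-reverse) (reverse G)

component-step : ∀ {a b c d X X′ r₁ r₂ r₃ r₄ T} → val (Seq.suc X) ⊆ val (Seq.suc X′) →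
  (RefutedAt c d X r₁ r₂ → Refutes (nbhdOf c d X r₁ r₂) X′) →
  AllWindows (a ∷ b ∷ c ∷ d ∷ X ∷ r₁ ∷ r₂ ∷ r₃ ∷ r₄ ∷ T) →
  AllWindows (a ∷ b ∷ c ∷ d ∷ X′ ∷ r₁ ∷ r₂ ∷ r₃ ∷ r₄ ∷ T)
component-step s centred (w₁ ∷ w₂ ∷ w₃ ∷ w₄ ∷ w₅ ∷ rest) =
  Refutes-⊑ (id , id , id , id , s) w₁ ∷
  Refutes-⊑ (id , id , id , s , id) w₂ ∷
  Refutes-⊑ (id , id , s , id , id) (centred w₃) ∷
  Refutes-⊑ (id , s , id , id , id) w₄ ∷
  Refutes-⊑ (s , id , id , id , id) w₅ ∷
  rest

weaken-step : ∀ {X X′} → X′ ⊆S X → Step (X ∷ []) (X′ ∷ [])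
weaken-step X′⊆X = step (component-step (val-antitone (proj₂ X′⊆X)) (Refutes-⊆S X′⊆X))

¬R-step : ∀ {Γ Δ φ} → Step ((Γ ⇒ ¬' φ ∷ Δ) ∷ []) ((φ ∷ Γ ⇒ Δ) ∷ [])
¬R-step = step (component-step (val-antitone there) λ { (hs , fails-¬ h ∷ fs) → h ∷ hs , fs })

∧R-step : ∀ {Γ Δ φ ψ} → Step₂ ((Γ ⇒ φ ∧' ψ ∷ Δ) ∷ []) ((Γ ⇒ φ ∷ Δ) ∷ []) ((Γ ⇒ ψ ∷ Δ) ∷ [])
∧R-step = step₂ λ where
  v@(_ ∷ _ ∷ (hs , fails-∧ˡ h ∷ fs) ∷ _) →
    inj₁ (component-step (val-replace-head λ ()) (λ _ → hs , fails-¬ h ∷ fs) v)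
  v@(_ ∷ _ ∷ (hs , fails-∧ʳ h ∷ fs) ∷ _) →
    inj₂ (component-step (val-replace-head λ ()) (λ _ → hs , fails-¬ h ∷ fs) v)

□L-step : ∀ {Γ Δ Σ Λ φ} → Step ((□ φ ∷ Γ ⇒ Δ) ∷ (Σ ⇒ Λ) ∷ []) ((Γ ⇒ Δ) ∷ (φ ∷ Σ ⇒ Λ) ∷ [])
□L-step = step λ where
  (w₁ ∷ w₂ ∷ (h ∷ hs , fs) ∷ (hs′ , fs′) ∷ w₅ ∷ w₆ ∷ rest) →
    w₁ ∷ w₂ ∷ (hs , fs) ∷ (Holds-□⁻ h ∷ hs′ , fs′) ∷ w₅ ∷ w₆ ∷ rest

EC-step : ∀ {S} → Step (S ∷ []) (S ∷ S ∷ [])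
EC-step = step λ where
  (w₁ ∷ w₂ ∷ w₃ ∷ w₄ ∷ rest) →
    w₁ ∷ Refutes-≼ ≼-dupʳ w₂ ∷ Refutes-≼ ≼-stutterʳ w₃ ∷ Refutes-≼ ≼-stutterˡ w₃ ∷ Refutes-≼ ≼-dupˡ w₄ ∷ rest

□R-step : ∀ {a b c d Γ Δ φ} → AllWindows (a ∷ b ∷ c ∷ d ∷ (Γ ⇒ □ φ ∷ Δ) ∷ ε⁴) →
          AllWindows (a ∷ b ∷ c ∷ d ∷ (Γ ⇒ Δ) ∷ ([] ⇒ φ ∷ []) ∷ ε⁴)
□R-step {Δ = Δ} (w₁ ∷ w₂ ∷ (hs , fails-□ {m} {n} (l , _) ∷ fs) ∷ _ ∷ _ ∷ rest) =
  Refutes-⊑ (id , id , id , id , X⊆) w₁ ∷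
  Refutes-⊑ (id , id , id , X⊆ , fresh) w₂ ∷
  Refutes-⊑ (id , id , X⊆ , fresh , id) (hs , fs) ∷
  ([] , Fails-fresh (Linked-mono id X⊆ l) ∷ []) ∷
  ([] , []) ∷ ([] , []) ∷ rest
  where
  X⊆ : val (□ χ m n ∷ Δ) ⊆ val Δ
  X⊆ = val-antitone there
  fresh : val [] ⊆ val (χ m n ∷ [])
  fresh _ = ∉-singleton λ ()

soundness : ∀ {G} → RB G → ¬ Refuted G
soundness (ax n) r with AllWindows-pad-centre [] _ [] r
... | _ , _ , _ , _ , (holds-var n∉ ∷ [] , _) = n∉ (here refl)
soundness (set-eq G≈G′ d) =
  soundness d ∘ AllWindows-pad-pointwise ⊆S-refl RefutedAt-antitone (Pointwise.map ≈S⇒⊆S G≈G′)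
soundness (EWl d) (_ ∷ r) = soundness d r
soundness (EWr {G} d) = soundness d ∘ AllWindows-pad-init G
soundness (IWL G H φ d) = soundness d ∘ AllWindows-pad-replace G H (weaken-step (there , id))
soundness (IWR G H φ d) = soundness d ∘ AllWindows-pad-replace G H (weaken-step (id , there))
soundness (¬L G H d) r with AllWindows-pad-centre G _ H r
... | _ , _ , _ , _ , (() ∷ _ , _)
soundness (¬R G H d) = soundness d ∘ AllWindows-pad-replace G H ¬R-step
soundness (∧L G H d) r with AllWindows-pad-centre G _ H r
... | _ , _ , _ , _ , (() ∷ _ , _)
soundness (∧R G H d₁ d₂) = [ soundness d₁ , soundness d₂ ]′ ∘ AllWindows-pad-replace₂ G H ∧R-step
soundness (∨L G H d₁ d₂) r with AllWindows-pad-centre G _ H r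
... | _ , _ , _ , _ , (() ∷ _ , _)
soundness (∨R G H d) r with AllWindows-pad-centre G _ H r
... | _ , _ , _ , _ , (_ , () ∷ _)
soundness (□R G d) = soundness d ∘ AllWindows-pad-replace-last G □R-step
soundness (□L G H d) = soundness d ∘ AllWindows-pad-replace G H □L-step
soundness (Sym {G} d) = soundness d ∘ Refuted-unreverse G
soundness (EC G H d) = soundness d ∘ AllWindows-pad-replace G H EC-step

-- The edge from ⇒ p to the middle component is linked by q, the edge to ⇒ q by p.
J-refuted : Refuted J
J-refuted =
  ([] , []) ∷ ([] , []) ∷
  ([] , fails-var ∷ []) ∷
  ([] , fails-□ (via₂ (∉-singleton (λ ())) (∉-singleton (λ ())) , via₁ (∉-singleton (λ ())) (∉-singleton (λ ()))) ∷ []) ∷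
  ([] , fails-var ∷ []) ∷
  ([] , []) ∷ ([] , []) ∷ tt ∷ tt ∷ tt ∷ tt ∷ []

mainTheorem18 : ¬ RB J
mainTheorem18 d = soundness d J-refuted
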